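{- Let $\Gamma$ be a triangulation of a connected closed $2$-dimensional surface and let $F,F'$ be adjacent faces (sharing an edge) whose $z$-monodromies satisfy $M_F=D_F$ and $M_{F'}=D_{F'}$. Then there is a unique (up to reversal) zigzag whose face shadow contains $F$ and $F'$, and (for a suitable choice among this zigzag and its reverse) its face shadow is a cyclic sequence of the form $$F,F',\dots,F,\dots,F',F,\dots,F',\dots,$$ where the dots denote segments containing neither $F$ nor $F'$ (the reversed zigzag then has face shadow $F',F,\dots,F',\dots,F,F',\dots,F,\dots$).
   Context: A triangulation of a surface $M$ is a closed $2$-cell embedding of a finite connected graph in $M$ such that every face contains exactly three edges, every edge lies in exactly two distinct faces, and the intersection of two distinct faces is an edge, a vertex, or empty. A zigzag is a sequence of edges $\{e_i\}$ such that for every $i$: $e_i,e_{i+1}$ share a vertex and lie in a common face; the faces containing $e_i,e_{i+1}$ and $e_{i+1},e_{i+2}$ are distinct, and $e_i,e_{i+2}$ are disjoint; it is cyclic, written $e_1,\dots,e_n$ with minimal period $n$, traverses each of its edges in a definite direction, and is determined by any two consecutive oriented edges. Its face shadow is the cyclic sequence $F_1,\dots,F_n$ with $F_i$ the face containing $e_i,e_{i+1}$. For a face $F$ with vertices $a,b,c$, $\Omega(F)=\{ab,bc,ca,ac,cb,ba\}$ is its set of oriented edges and $D_F=(ab,bc,ca)(ac,cb,ba)$. The $z$-monodromy $M_F$ is the permutation of $\Omega(F)$ given by: for $e\in\Omega(F)$ take $e_0$ with $D_F(e_0)=e$, follow the zigzag containing the consecutive oriented edges $e_0,e$, and let $M_F(e)$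 be the first element of $\Omega(F)$ occurring in this zigzag after $e$. -}

module Defs where

open import Data.Nat using (ℕ; zero; suc; _<_; _≤_)
open import Data.Fin using (Fin)
open import Data.Integer using (ℤ; +_; _-_) renaming (_+_ to _+ℤ_)
open import Data.Product using (Σ; ∃; ∃-syntax; _×_; _,_)
open import Data.Sum using (_⊎_)
open import Relation.Binary.PropositionalEquality using (_≡_; _≢_)
open import Relation.Nullary using (¬_)
open import Function.Bundles using (_⇔_)
open import Function.Definitions using (Injective)

_⊕_ : ℤ → ℕ → ℤ
i ⊕ k = i +ℤ (+ k)

record Complex : Set where
  field
    nV nF : ℕ
    vert : Fin nF → Fin 3 → Fin nV

module _ (K : Complex) where
  open Complex K

  V : Set
  V = Fin nV

  Face : Set
  Face = Fin nF

  _∈F_ : V → Face → Set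
  v ∈F f = ∃[ i ] vert f i ≡ v

  Edge : V → V → Set
  Edge u w = u ≢ w × ∃[ f ] (u ∈F f × w ∈F f)

  data VPath : V → V → Set where
    here : ∀ {u} → VPath u u
    step : ∀ {u w x} → Edge u w → VPath w x → VPath u x

  -- paths in the link of v: faces around v, consecutive ones sharing an edge through v
  data LinkPath (v : V) : Face → Face → Set where
    here : ∀ {f} → LinkPath v f f
    step : ∀ {f g h} (u : V) → u ≢ v → u ∈F f → u ∈F g → v ∈F g →
           LinkPath v g h → LinkPath v f h

  -- triangulation of a connected closed surface
  record IsTriangulation : Set where
    field
      three-vertices : ∀ f → Injective _≡_ _≡_ (vert f)
      faces-distinct : ∀ f g → (∀ v → (v ∈F f) ⇔ (v ∈F g)) → f ≡ g
      edge-in-two-faces : ∀ f u w → u ≢ w → u ∈F f → w ∈F f →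
        ∃[ g ] (g ≢ f × u ∈F g × w ∈F g ×
                (∀ h → u ∈F h → w ∈F h → h ≡ f ⊎ h ≡ g))
      vertex-links-connected : ∀ v f g → v ∈F f → v ∈F g → LinkPath v f g
      connected : ∀ u w → VPath u w

  InFace3 : Face → V → V → V → Set
  InFace3 f a b c = a ∈F f × b ∈F f × c ∈F f

  -- A zigzag is given by its vertex sequence v : ℤ → V, the i-th oriented
  -- edge being e_i = (v i , v (i+1)).
  record IsZigzag (v : ℤ → V) : Set where
    field
      is-edge : ∀ i → v i ≢ v (i ⊕ 1)
      common-face : ∀ i → ∃[ f ] InFace3 f (v i) (v (i ⊕ 1)) (v (i ⊕ 2))
      faces-differ : ∀ i f g → InFace3 f (v i) (v (i ⊕ 1)) (v (i ⊕ 2)) →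
        InFace3 g (v (i ⊕ 1)) (v (i ⊕ 2)) (v (i ⊕ 3)) → f ≢ g
      disjoint : ∀ i → v i ≢ v (i ⊕ 2) × v i ≢ v (i ⊕ 3) ×
                       v (i ⊕ 1) ≢ v (i ⊕ 2) × v (i ⊕ 1) ≢ v (i ⊕ 3)
      cyclic : ∃[ n ] (0 < n × (∀ i → v (i ⊕ n) ≡ v i))

  -- face shadow: F_i is the face containing e_i, e_{i+1}
  Shadow : (ℤ → V) → ℤ → Face → Set
  Shadow v i f = InFace3 f (v i) (v (i ⊕ 1)) (v (i ⊕ 2))

  ShadowContains : (ℤ → V) → Face → Set
  ShadowContains v f = ∃[ i ] Shadow v i f

  SameZ : (ℤ → V) → (ℤ → V) → Set
  SameZ v w = ∃[ k ] (∀ i → w i ≡ v (i +ℤ k))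

  RevZ : (ℤ → V) → (ℤ → V) → Set
  RevZ v w = ∃[ k ] (∀ i → w i ≡ v (k - i))

  SameOrRev : (ℤ → V) → (ℤ → V) → Set
  SameOrRev v w = SameZ v w ⊎ RevZ v w

  MinPeriod : (ℤ → V) → ℕ → Set
  MinPeriod v n = 0 < n × (∀ i → v (i ⊕ n) ≡ v i) ×
    (∀ m → 0 < m → m < n → ¬ (∀ i → v (i ⊕ m) ≡ v i))

  -- face shadow (one period, starting at index 0) has the form
  -- F,F',…,F,…,F',F,…,F',…   (… = possibly empty segments without F, F')
  Pattern : (ℤ → V) → Face → Face → Set
  Pattern v F F' = ∃[ n ] (MinPeriod v n × ∃[ a ] ∃[ b ] ∃[ c ]
    (1 < a × a < b × suc b < c × c < n ×
     S 0 F × S 1 F' × S a F × S b F' × S (suc b) F × S c F' ×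
     (∀ j → j < n → j ≢ 0 → j ≢ 1 → j ≢ a → j ≢ b → j ≢ suc b → j ≢ c →
        ¬ S j F × ¬ S j F')))
    where
    S : ℕ → Face → Set
    S j f = Shadow v (+ j) f

  -- z-monodromy M_F equals D_F: for every oriented edge (y,z) of F with third
  -- vertex x (so D_F(x,y) = (y,z)), the zigzag through (x,y),(y,z) meets
  -- Ω(F) again first at D_F(y,z) = (z,x).
  MonodromyIsD : Face → Set
  MonodromyIsD F = ∀ x y z → InFace3 F x y z → x ≢ y → y ≢ z → x ≢ z →
    ∃[ v ] (IsZigzag v × v (+ 0) ≡ x × v (+ 1) ≡ y × v (+ 2) ≡ z ×
      ∃[ j ] (2 ≤ j × v (+ j) ≡ z × v (+ suc j) ≡ x ×
        (∀ k → 2 ≤ k → k < j → ¬ (v (+ k) ∈F F × v (+ suc k) ∈F F))))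

  Adjacent : Face → Face → Set
  Adjacent F F' = F ≢ F' × ∃[ u ] ∃[ w ]
    (u ≢ w × u ∈F F × w ∈F F × u ∈F F' × w ∈F F')

module Submission where

-- Write F = xyz and F' = yzw (shared edge yz).  M_F = D_F provides a zigzag v
-- through the oriented edges xy, yz, i.e. with flag (x,y,z) at position 0;
-- crossing yz it has flag (y,z,w) at 1.  Reading M_F = D_F once and
-- M_F' = D_F' twice along v locates its returns to the two faces: flags
-- (z,x,y) at a, (w,y,z) at b, (y,z,x) at b + 1 (crossing yz back into F) and
-- (z,w,y) at c, where 1 < a < b < b + 1 < c < n for the minimal period n.  Rigidity: a zigzag is determined
-- by three consecutive vertices, so within a period each oriented flag occurs
-- at most once and never together with its reverse.  Orientation: an ordered
-- triple of distinct vertices of a face is a rotation of xyz or of zyx.  Hence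
-- F and F' occur in the shadow of v exactly at 0, a, b + 1 and at 1, b, c, and
-- every zigzag through F is a shift or a reflection of v.

open import Defs
open import Data.Integer using (ℤ)
open import Data.Product using (Σ; ∃-syntax; _×_)

open import Data.Nat as N using (ℕ; zero; suc; z≤n; s≤s)
import Data.Nat.Properties as NP
open import Data.Nat.Induction using (<-rec)
open import Data.Integer using (+_; -[1+_]) renaming (_+_ to _+ℤ_; _-_ to _-ℤ_)
import Data.Integer.Properties as ZP
open import Data.Integer.Tactic.RingSolver using (solve-∀)
open import Data.Fin using (Fin)
open import Data.Fin.Properties using (_≟_; all?; any?)
open import Data.Product using (_,_; proj₁; proj₂; ∃)
open import Data.Sum as Sum using (_⊎_; inj₁; inj₂; [_,_]′)
open import Data.Empty using (⊥; ⊥-elim)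
open import Relation.Binary.PropositionalEquality
open import Relation.Binary.Definitions using (tri<; tri≈; tri>)
open import Relation.Unary using (Decidable)
open import Relation.Nullary using (¬_; Dec; yes; no)
open import Relation.Nullary.Decidable using (from-yes; ¬?; _×-dec_; _⊎-dec_; _→-dec_)
open import Function.Bundles using (mk⇔)

⊕-assoc : ∀ i a b → (i ⊕ a) ⊕ b ≡ i ⊕ (a N.+ b)
⊕-assoc i a b = ZP.+-assoc i (+ a) (+ b)

+-⊕ : ∀ j k → (+ j) ⊕ k ≡ + (k N.+ j)
+-⊕ j k = cong +_ (NP.+-comm j k)

swap-shifts : ∀ (i k q : ℤ) → (i +ℤ k) +ℤ q ≡ (i +ℤ q) +ℤ k
swap-shifts = solve-∀
mirror-shift : ∀ (k i m : ℤ) → k -ℤ i ≡ (k -ℤ (i +ℤ m)) +ℤ m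
mirror-shift = solve-∀
mirror₂ : ∀ (k i : ℤ) → k -ℤ (i +ℤ + 1) ≡ (k -ℤ (i +ℤ + 3)) +ℤ + 2
mirror₂ = solve-∀
mirror₁ : ∀ (k i : ℤ) → k -ℤ (i +ℤ + 2) ≡ (k -ℤ (i +ℤ + 3)) +ℤ + 1
mirror₁ = solve-∀
mirror-even : ∀ (q : ℤ) → (q +ℤ q) -ℤ (q -ℤ + 1) ≡ (q -ℤ + 1) +ℤ + 2
mirror-even = solve-∀
mirror-odd : ∀ (q : ℤ) → (+ 1 +ℤ (q +ℤ q)) -ℤ q ≡ q +ℤ + 1
mirror-odd = solve-∀
translate₀ : ∀ (i q : ℤ) → i +ℤ (q -ℤ i) ≡ q
translate₀ = solve-∀
translate : ∀ (i q m : ℤ) → (i +ℤ m) +ℤ (q -ℤ i) ≡ q +ℤ m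
translate = solve-∀
reflect₀ : ∀ (i q : ℤ) → (i +ℤ (q +ℤ + 2)) -ℤ i ≡ q +ℤ + 2
reflect₀ = solve-∀
reflect₁ : ∀ (i q : ℤ) → (i +ℤ (q +ℤ + 2)) -ℤ (i +ℤ + 1) ≡ q +ℤ + 1
reflect₁ = solve-∀
reflect₂ : ∀ (i q : ℤ) → (i +ℤ (q +ℤ + 2)) -ℤ (i +ℤ + 2) ≡ q
reflect₂ = solve-∀

ℤ-induction : (P : ℤ → Set) → P (+ 0) → (∀ t → P t → P (t ⊕ 1)) → (∀ t → P (t ⊕ 1) → P t) →
              ∀ t → P t
ℤ-induction P base up down (+ n) = upwards n
  where
  upwards : ∀ n → P (+ n)
  upwards zero = base
  upwards (suc n) = subst P (+-⊕ n 1) (up (+ n) (upwards n))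
ℤ-induction P base up down -[1+ n ] = downwards n
  where
  downwards : ∀ n → P -[1+ n ]
  downwards zero = down -[1+ 0 ] base
  downwards (suc n) = down -[1+ suc n ] (downwards n)

even-or-odd : ∀ k → (∃ λ m → k ≡ m N.+ m) ⊎ (∃ λ m → k ≡ suc (m N.+ m))
even-or-odd zero = inj₁ (0 , refl)
even-or-odd (suc k) with even-or-odd k
... | inj₁ (m , e) = inj₂ (m , cong suc e)
... | inj₂ (m , e) = inj₁ (suc m , cong suc (trans e (sym (NP.+-suc m m))))

least-witness : {P : ℕ → Set} → Decidable P → ∀ N → P N →
                Σ ℕ λ n → P n × (∀ k → k N.< n → ¬ P k)
least-witness {P} P? = <-rec _ search
  where
  search : ∀ N → (∀ {m} → m N.< N → P m → Σ ℕ λ n → P n × (∀ k → k N.< n → ¬ P k)) →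
           P N → Σ ℕ λ n → P n × (∀ k → k N.< n → ¬ P k)
  search N smaller pN with NP.anyUpTo? P? N
  ... | yes (m , m<N , pm) = smaller m<N pm
  ... | no none = N , pN , λ k k<N pk → none (k , k<N , pk)

Distinct : {A : Set} → A → A → A → Set
Distinct a b c = a ≢ b × a ≢ c × b ≢ c

rotate-distinct : {A : Set} {a b c : A} → Distinct a b c → Distinct b c a
rotate-distinct (ab , ac , bc) = bc , (λ e → ab (sym e)) , (λ e → ac (sym e))

Rotation : {A : Set} → A → A → A → A → A → A → Set
Rotation a b c p q r =
  (p ≡ a × q ≡ b × r ≡ c) ⊎ (p ≡ b × q ≡ c × r ≡ a) ⊎ (p ≡ c × q ≡ a × r ≡ b)

rotation-map : {A B : Set} (g : A → B) → ∀ {a b c p q r} → Rotation a b c p q r →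
               Rotation (g a) (g b) (g c) (g p) (g q) (g r)
rotation-map g (inj₁ (refl , refl , refl)) = inj₁ (refl , refl , refl)
rotation-map g (inj₂ (inj₁ (refl , refl , refl))) = inj₂ (inj₁ (refl , refl , refl))
rotation-map g (inj₂ (inj₂ (refl , refl , refl))) = inj₂ (inj₂ (refl , refl , refl))

distinct? : (a b c : Fin 3) → Dec (Distinct a b c)
distinct? a b c = ¬? (a ≟ b) ×-dec ¬? (a ≟ c) ×-dec ¬? (b ≟ c)

rotation? : (a b c p q r : Fin 3) → Dec (Rotation a b c p q r)
rotation? a b c p q r = (p ≟ a ×-dec q ≟ b ×-dec r ≟ c) ⊎-dec
  (p ≟ b ×-dec q ≟ c ×-dec r ≟ a) ⊎-dec (p ≟ c ×-dec q ≟ a ×-dec r ≟ b)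

fin3-exhausted : ∀ (a b c d : Fin 3) → Distinct a b c → d ≡ a ⊎ d ≡ b ⊎ d ≡ c
fin3-exhausted = from-yes (all? {n = 3} λ a → all? {n = 3} λ b → all? {n = 3} λ c →
  all? {n = 3} λ d → distinct? a b c →-dec (d ≟ a ⊎-dec d ≟ b ⊎-dec d ≟ c))

fin3-third : ∀ (a b : Fin 3) → a ≢ b → Σ (Fin 3) λ c → c ≢ a × c ≢ b
fin3-third = from-yes (all? {n = 3} λ a → all? {n = 3} λ b →
  ¬? (a ≟ b) →-dec any? {n = 3} λ c → ¬? (c ≟ a) ×-dec ¬? (c ≟ b))

fin3-orientation : ∀ (a b c p q r : Fin 3) → Distinct a b c → Distinct p q r →
                   Rotation a b c p q r ⊎ Rotation c b a p q r
fin3-orientation = from-yes (all? {n = 3} λ a → all? {n = 3} λ b → all? {n = 3} λ c →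
  all? {n = 3} λ p → all? {n = 3} λ q → all? {n = 3} λ r →
  distinct? a b c →-dec (distinct? p q r →-dec (rotation? a b c p q r ⊎-dec rotation? c b a p q r)))

module Sequences (K : Complex) where

  rotate-InFace3 : ∀ {f a b c} → InFace3 K f a b c → InFace3 K f b c a
  rotate-InFace3 (af , bf , cf) = bf , cf , af

  ShadowAt : (ℤ → V K) → ℕ → Face K → Set
  ShadowAt u j f = InFace3 K f (u (+ j)) (u (+ suc j)) (u (+ suc (suc j)))

  FlagAt : (ℤ → V K) → ℕ → V K → V K → V K → Set
  FlagAt u j a b c = u (+ j) ≡ a × u (+ suc j) ≡ b × u (+ suc (suc j)) ≡ c

  FlagFrom : (ℤ → V K) → ℤ → V K → V K → V K → Set
  FlagFrom u i a b c = u i ≡ a × u (i ⊕ 1) ≡ b × u (i ⊕ 2) ≡ c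

  flagAt⇒flagFrom : ∀ {u j a b c} → FlagAt u j a b c → FlagFrom u (+ j) a b c
  flagAt⇒flagFrom {u} {j} (e₀ , e₁ , e₂) =
    e₀ , trans (cong u (+-⊕ j 1)) e₁ , trans (cong u (+-⊕ j 2)) e₂

  flag-shadow : ∀ {u j a b c f} → FlagAt u j a b c → InFace3 K f a b c → ShadowAt u j f
  flag-shadow (refl , refl , refl) abc = abc

  positions-differ : ∀ u {i j p q r p' q' r'} → FlagAt u i p q r → FlagAt u j p' q' r' →
                     p ≢ p' → i ≢ j
  positions-differ u (refl , _) (e , _) p≢p' refl = p≢p' e

  SameOrRev-refl : ∀ u → SameOrRev K u u
  SameOrRev-refl u = inj₁ (+ 0 , λ i → cong u (sym (ZP.+-identityʳ i)))

  module _ (u : ℤ → V K) where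
    ≢-reindex : ∀ {i j i' j'} → u i ≢ u j → i ≡ i' → j ≡ j' → u i' ≢ u j'
    ≢-reindex ne refl refl = ne

    InFace3-reindex : ∀ {f i j k i' j' k'} → i ≡ i' → j ≡ j' → k ≡ k' →
                      InFace3 K f (u i) (u j) (u k) → InFace3 K f (u i') (u j') (u k')
    InFace3-reindex refl refl refl h = h

    shadow⇒shadowAt : ∀ j f → Shadow K u (+ j) f → ShadowAt u j f
    shadow⇒shadowAt j f = InFace3-reindex refl (+-⊕ j 1) (+-⊕ j 2)

    shadowAt⇒shadow : ∀ j f → ShadowAt u j f → Shadow K u (+ j) f
    shadowAt⇒shadow j f = InFace3-reindex refl (sym (+-⊕ j 1)) (sym (+-⊕ j 2))

    flag-in-shadow : ∀ j {a b c f} → FlagAt u j a b c → InFace3 K f a b c → Shadow K u (+ j) f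
    flag-in-shadow j {f = f} Fj abc = shadowAt⇒shadow j f (flag-shadow {u} {j} Fj abc)

  module ZigzagAt {u : ℤ → V K} (Zu : IsZigzag K u) where
    open IsZigzag Zu

    edge-at : ∀ j → u (+ j) ≢ u (+ suc j)
    edge-at j = ≢-reindex u (is-edge (+ j)) refl (+-⊕ j 1)

    disjoint-at : ∀ j → u (+ j) ≢ u (+ suc (suc j)) × u (+ j) ≢ u (+ suc (suc (suc j))) ×
                        u (+ suc j) ≢ u (+ suc (suc j)) × u (+ suc j) ≢ u (+ suc (suc (suc j)))
    disjoint-at j with disjoint (+ j)
    ... | d02 , d03 , d12 , d13 = ≢-reindex u d02 refl (+-⊕ j 2) , ≢-reindex u d03 refl (+-⊕ j 3) ,
          ≢-reindex u d12 (+-⊕ j 1) (+-⊕ j 2) , ≢-reindex u d13 (+-⊕ j 1) (+-⊕ j 3)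

    distinct-at : ∀ j → Distinct (u (+ j)) (u (+ suc j)) (u (+ suc (suc j)))
    distinct-at j = edge-at j , proj₁ (disjoint-at j) , edge-at (suc j)

    distinct-after : ∀ i → Distinct (u i) (u (i ⊕ 1)) (u (i ⊕ 2))
    distinct-after i =
      is-edge i , proj₁ (disjoint i) , ≢-reindex u (is-edge (i ⊕ 1)) refl (⊕-assoc i 1 1)

    edge-after₂ : ∀ i → u (i ⊕ 2) ≢ u (i ⊕ 3)
    edge-after₂ i = ≢-reindex u (is-edge (i ⊕ 2)) refl (⊕-assoc i 2 1)

    face-at : ∀ j → Σ (Face K) λ g → ShadowAt u j g
    face-at j = let (g , h) = common-face (+ j) in g , shadow⇒shadowAt u j g h

    face-after₁ : ∀ i → Σ (Face K) λ g → InFace3 K g (u (i ⊕ 1)) (u (i ⊕ 2)) (u (i ⊕ 3))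
    face-after₁ i = let (g , h) = common-face (i ⊕ 1) in
      g , InFace3-reindex u refl (⊕-assoc i 1 1) (⊕-assoc i 1 2) h

    faces-differ-at : ∀ j f g → ShadowAt u j f → ShadowAt u (suc j) g → f ≢ g
    faces-differ-at j f g Sf Sg = faces-differ (+ j) f g (shadowAt⇒shadow u j f Sf)
      (InFace3-reindex u (sym (+-⊕ j 1)) (sym (+-⊕ j 2)) (sym (+-⊕ j 3)) Sg)

  reindex-zigzag : ∀ {u} → IsZigzag K u → (σ : ℤ → ℤ) → (∀ i k → σ (i ⊕ k) ≡ σ i ⊕ k) →
                   IsZigzag K (λ t → u (σ t))
  reindex-zigzag {u} Zu σ hσ = record
    { is-edge = λ i → ≢-reindex u (is-edge (σ i)) refl (sym (hσ i 1))
    ; common-face = λ i → let (f , m) = common-face (σ i) in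
        f , InFace3-reindex u refl (sym (hσ i 1)) (sym (hσ i 2)) m
    ; faces-differ = λ i f g F G → faces-differ (σ i) f g
        (InFace3-reindex u refl (hσ i 1) (hσ i 2) F) (InFace3-reindex u (hσ i 1) (hσ i 2) (hσ i 3) G)
    ; disjoint = λ i → let (d02 , d03 , d12 , d13) = disjoint (σ i) in
        ≢-reindex u d02 refl (sym (hσ i 2)) , ≢-reindex u d03 refl (sym (hσ i 3)) ,
        ≢-reindex u d12 (sym (hσ i 1)) (sym (hσ i 2)) , ≢-reindex u d13 (sym (hσ i 1)) (sym (hσ i 3))
    ; cyclic = let (n , n>0 , per) = cyclic in n , n>0 , λ i → trans (cong u (hσ i n)) (per (σ i))
    }
    where open IsZigzag Zu

  shift-zigzag : ∀ {u} → IsZigzag K u → ∀ q → IsZigzag K (λ t → u (t +ℤ q))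
  shift-zigzag Zu q = reindex-zigzag Zu (λ t → t +ℤ q) (λ i k → swap-shifts i (+ k) q)

  -- The reversal of a zigzag is a zigzag: the triple at i of the reversal is the
  -- reversed triple at k - (i + 3) of the original.
  reverse-zigzag : ∀ {u} → IsZigzag K u → ∀ k → IsZigzag K (λ t → u (k -ℤ t))
  reverse-zigzag {u} Zu k = record
    { is-edge = λ i →
        ≢-reindex u (λ e → edge-after₂ (opposite i) (sym e)) (sym (m₃ i)) (sym (mirror₂ k i))
    ; common-face = λ i → let (g , G) = face-after₁ (opposite i) in
        g , (∈-at (sym (m₃ i)) (proj₂ (proj₂ G)) , ∈-at (sym (mirror₂ k i)) (proj₁ (proj₂ G)) ,
             ∈-at (sym (mirror₁ k i)) (proj₁ G))
    ; faces-differ = λ i f g Fh Gh e → faces-differ (opposite i) g f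
        (proj₂ (proj₂ Gh) , ∈-at (mirror₁ k i) (proj₁ (proj₂ Gh)) , ∈-at (mirror₂ k i) (proj₁ Gh))
        (∈-at (mirror₁ k i) (proj₂ (proj₂ Fh)) , ∈-at (mirror₂ k i) (proj₁ (proj₂ Fh)) ,
         ∈-at (m₃ i) (proj₁ Fh))
        (sym e)
    ; disjoint = λ i → let (d02 , d03 , d12 , d13) = disjoint (opposite i) in
        ≢-reindex u (λ e → d13 (sym e)) (sym (m₃ i)) (sym (mirror₁ k i)) ,
        ≢-reindex u (λ e → d03 (sym e)) (sym (m₃ i)) refl ,
        ≢-reindex u (λ e → d12 (sym e)) (sym (mirror₂ k i)) (sym (mirror₁ k i)) ,
        ≢-reindex u (λ e → d02 (sym e)) (sym (mirror₂ k i)) refl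
    ; cyclic = let (n , n>0 , per) = cyclic in
        n , n>0 , λ i → sym (trans (cong u (mirror-shift k i (+ n))) (per (k -ℤ (i ⊕ n))))
    }
    where
    open IsZigzag Zu
    open ZigzagAt Zu
    opposite : ℤ → ℤ
    opposite i = k -ℤ (i ⊕ 3)
    m₃ : ∀ i → k -ℤ i ≡ opposite i ⊕ 3
    m₃ i = mirror-shift k i (+ 3)
    ∈-at : ∀ {s t f} → s ≡ t → _∈F_ K (u s) f → _∈F_ K (u t) f
    ∈-at {f = f} e = subst (λ r → _∈F_ K (u r) f) e

  -- No zigzag is a reflection of itself: at the centre of the reflection two
  -- vertices at distance 1 or 2 would coincide.
  no-self-reflection : ∀ {u} → IsZigzag K u → ∀ k → ¬ (∀ s → u s ≡ u (+ k -ℤ s))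
  no-self-reflection {u} Zu k mirror with even-or-odd k
  ... | inj₁ (m , refl) = proj₁ (IsZigzag.disjoint Zu s) (trans (mirror s) (cong u (mirror-even (+ m))))
    where s = + m -ℤ + 1
  ... | inj₂ (m , refl) = IsZigzag.is-edge Zu (+ m) (trans (mirror (+ m)) (cong u (mirror-odd (+ m))))

module Triangulated (K : Complex) (T : IsTriangulation K) where
  open IsTriangulation T
  open Complex K using (vert)
  open Sequences K

  _∈ᶠ_ : V K → Face K → Set
  a ∈ᶠ f = _∈F_ K a f

  ∈-resp : ∀ {a b f} → a ≡ b → a ∈ᶠ f → b ∈ᶠ f
  ∈-resp refl m = m

  indices-distinct : ∀ f {i j} → vert f i ≢ vert f j → i ≢ j
  indices-distinct f ne e = ne (cong (vert f) e)

  vertex-cases : ∀ {f a b c d} → InFace3 K f a b c → Distinct a b c → d ∈ᶠ f →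
                 d ≡ a ⊎ d ≡ b ⊎ d ≡ c
  vertex-cases {f} ((ia , refl) , (ib , refl) , (ic , refl)) (ab , ac , bc) (id , refl) =
    Sum.map (cong (vert f)) (Sum.map (cong (vert f)) (cong (vert f)))
      (fin3-exhausted ia ib ic id
        (indices-distinct f ab , indices-distinct f ac , indices-distinct f bc))

  last-vertex : ∀ {f a b c d} → InFace3 K f a b c → Distinct a b c → d ∈ᶠ f →
                d ≢ a → d ≢ b → d ≡ c
  last-vertex abc dist df da db with vertex-cases abc dist df
  ... | inj₁ e = ⊥-elim (da e)
  ... | inj₂ (inj₁ e) = ⊥-elim (db e)
  ... | inj₂ (inj₂ e) = e

  third-vertex : ∀ {f a b} → a ∈ᶠ f → b ∈ᶠ f → a ≢ b → Σ (V K) λ c → c ∈ᶠ f × c ≢ a × c ≢ b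
  third-vertex {f} (ia , refl) (ib , refl) ab with fin3-third ia ib (indices-distinct f ab)
  ... | ic , ca , cb = vert f ic , (ic , refl) ,
        (λ e → ca (three-vertices f e)) , (λ e → cb (three-vertices f e))

  face-determined : ∀ {f g a b c} → InFace3 K f a b c → InFace3 K g a b c → Distinct a b c → f ≡ g
  face-determined {f} {g} {a} {b} {c} abc-f abc-g dist =
    faces-distinct f g (λ d → mk⇔ (included abc-f abc-g) (included abc-g abc-f))
    where
    included : ∀ {h h' d} → InFace3 K h a b c → InFace3 K h' a b c → d ∈ᶠ h → d ∈ᶠ h'
    included abc (a' , b' , c') dh with vertex-cases abc dist dh
    ... | inj₁ refl = a'
    ... | inj₂ (inj₁ refl) = b'
    ... | inj₂ (inj₂ refl) = c'

  orientation : ∀ {f a b c p q r} → InFace3 K f a b c → Distinct a b c →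
                InFace3 K f p q r → Distinct p q r → Rotation a b c p q r ⊎ Rotation c b a p q r
  orientation {f} ((ia , refl) , (ib , refl) , (ic , refl)) (ab , ac , bc)
                  ((ip , refl) , (iq , refl) , (ir , refl)) (pq , pr , qr) =
    Sum.map (rotation-map (vert f)) (rotation-map (vert f))
      (fin3-orientation ia ib ic ip iq ir
        (indices-distinct f ab , indices-distinct f ac , indices-distinct f bc)
        (indices-distinct f pq , indices-distinct f pr , indices-distinct f qr))

  edge-faces : ∀ {f h h' a b} → a ∈ᶠ f → b ∈ᶠ f → a ≢ b → a ∈ᶠ h → b ∈ᶠ h → a ∈ᶠ h' → b ∈ᶠ h' →
               h ≡ f ⊎ h' ≡ f ⊎ h ≡ h'
  edge-faces {f} {h} {h'} {a} {b} af bf ab ah bh ah' bh'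
    with edge-in-two-faces f a b ab af bf
  ... | g , _ , _ , _ , only-f-g with only-f-g h ah bh | only-f-g h' ah' bh'
  ...   | inj₁ h≡f | _ = inj₁ h≡f
  ...   | inj₂ _ | inj₁ h'≡f = inj₂ (inj₁ h'≡f)
  ...   | inj₂ h≡g | inj₂ h'≡g = inj₂ (inj₂ (trans h≡g (sym h'≡g)))

  opposite-vertex-unique : ∀ {f h h' a b c c'} → a ∈ᶠ f → b ∈ᶠ f → a ≢ b →
    h ≢ f → InFace3 K h a b c → c ≢ a → c ≢ b →
    h' ≢ f → InFace3 K h' a b c' → c' ≢ a → c' ≢ b → c ≡ c'
  opposite-vertex-unique af bf ab h≢f (ah , bh , ch) ca cb h'≢f (ah' , bh' , ch') c'a c'b
    with edge-faces af bf ab ah bh ah' bh'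
  ... | inj₁ h≡f = ⊥-elim (h≢f h≡f)
  ... | inj₂ (inj₁ h'≡f) = ⊥-elim (h'≢f h'≡f)
  ... | inj₂ (inj₂ refl) =
    sym (last-vertex (ah , bh , ch) (ab , (λ e → ca (sym e)) , (λ e → cb (sym e))) ch' c'a c'b)

  module ZigzagDynamics {u : ℤ → V K} (Zu : IsZigzag K u) where
    open ZigzagAt Zu

    next-face : ∀ j {f f'} → ShadowAt u j f → f' ≢ f → u (+ suc j) ∈ᶠ f' → u (+ suc (suc j)) ∈ᶠ f' →
                ShadowAt u (suc j) f'
    next-face j {f} {f'} Sf f'≢f m₁ m₂ with face-at (suc j)
    ... | g , Sg with edge-faces (proj₁ (proj₂ Sf)) (proj₂ (proj₂ Sf)) (edge-at (suc j))
                        (proj₁ Sg) (proj₁ (proj₂ Sg)) m₁ m₂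
    ...   | inj₁ g≡f = ⊥-elim (faces-differ-at j f g Sf Sg (sym g≡f))
    ...   | inj₂ (inj₁ f'≡f) = ⊥-elim (f'≢f f'≡f)
    ...   | inj₂ (inj₂ refl) = Sg

    entering-face : ∀ j f → ¬ (u (+ j) ∈ᶠ f) → u (+ suc j) ∈ᶠ f → u (+ suc (suc j)) ∈ᶠ f →
                    ShadowAt u (suc j) f
    entering-face j f out m₁ m₂ with face-at j | face-at (suc j)
    ... | g , Sg | h , Sh with edge-faces m₁ m₂ (edge-at (suc j))
                                 (proj₁ (proj₂ Sg)) (proj₂ (proj₂ Sg)) (proj₁ Sh) (proj₁ (proj₂ Sh))
    ...   | inj₁ refl = ⊥-elim (out (proj₁ Sg))
    ...   | inj₂ (inj₁ refl) = Sh
    ...   | inj₂ (inj₂ refl) = ⊥-elim (faces-differ-at j g g Sg Sh refl)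

    cross-edge : ∀ j {f g a b c d} → FlagAt u j a b c → InFace3 K f a b c → g ≢ f →
                 InFace3 K g b c d → Distinct b c d → FlagAt u (suc j) b c d
    cross-edge j {g = g} Fj abc g≢f (bg , cg , dg) bcd@(bc , bd , cd) =
      proj₁ (proj₂ Fj) , proj₂ (proj₂ Fj) ,
      last-vertex (bg , cg , dg) bcd (proj₂ (proj₂ crossed))
        (λ e → proj₂ (proj₂ (proj₂ (disjoint-at j))) (trans (proj₁ (proj₂ Fj)) (sym e)))
        (λ e → edge-at (suc (suc j)) (trans (proj₂ (proj₂ Fj)) (sym e)))
      where
      crossed : ShadowAt u (suc j) g
      crossed = next-face j (flag-shadow {u} {j} Fj abc) g≢f
        (∈-resp (sym (proj₁ (proj₂ Fj))) bg) (∈-resp (sym (proj₂ (proj₂ Fj))) cg)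

  -- Rigidity: three consecutive vertices of a zigzag determine the next and the
  -- previous one (the opposite vertex across the middle edge), hence the whole zigzag.
  step-forward : ∀ {u u'} → IsZigzag K u → IsZigzag K u' → ∀ i → u i ≡ u' i →
                 u (i ⊕ 1) ≡ u' (i ⊕ 1) → u (i ⊕ 2) ≡ u' (i ⊕ 2) → u (i ⊕ 3) ≡ u' (i ⊕ 3)
  step-forward {u} {u'} Zu Zu' i e₀ e₁ e₂
    with IsZigzag.common-face Zu i | ZigzagAt.face-after₁ Zu i | ZigzagAt.face-after₁ Zu' i
  ... | f , Fu | g , Gu | g' , Gu' =
    opposite-vertex-unique (proj₁ (proj₂ Fu)) (proj₂ (proj₂ Fu))
      (proj₂ (proj₂ (ZigzagAt.distinct-after Zu i)))
      (λ e → f≢g (sym e)) Gu (λ e → d₁₃ (sym e)) (λ e → ZigzagAt.edge-after₂ Zu i (sym e))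
      (λ e → f≢g' (sym e))
      (∈-resp (sym e₁) (proj₁ Gu') , ∈-resp (sym e₂) (proj₁ (proj₂ Gu')) , proj₂ (proj₂ Gu'))
      (λ e → d₁₃' (trans (sym e₁) (sym e)))
      (λ e → ZigzagAt.edge-after₂ Zu' i (trans (sym e₂) (sym e)))
    where
    f≢g : f ≢ g
    f≢g = IsZigzag.faces-differ Zu i f g Fu Gu
    f≢g' : f ≢ g'
    f≢g' = IsZigzag.faces-differ Zu' i f g'
      (∈-resp e₀ (proj₁ Fu) , ∈-resp e₁ (proj₁ (proj₂ Fu)) , ∈-resp e₂ (proj₂ (proj₂ Fu))) Gu'
    d₁₃ : u (i ⊕ 1) ≢ u (i ⊕ 3)
    d₁₃ = proj₂ (proj₂ (proj₂ (IsZigzag.disjoint Zu i)))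
    d₁₃' : u' (i ⊕ 1) ≢ u' (i ⊕ 3)
    d₁₃' = proj₂ (proj₂ (proj₂ (IsZigzag.disjoint Zu' i)))

  step-backward : ∀ {u u'} → IsZigzag K u → IsZigzag K u' → ∀ i → u (i ⊕ 1) ≡ u' (i ⊕ 1) →
                  u (i ⊕ 2) ≡ u' (i ⊕ 2) → u (i ⊕ 3) ≡ u' (i ⊕ 3) → u i ≡ u' i
  step-backward {u} {u'} Zu Zu' i e₁ e₂ e₃
    with ZigzagAt.face-after₁ Zu i | IsZigzag.common-face Zu i | IsZigzag.common-face Zu' i
  ... | f , Fu | g , (g₀ , g₁ , g₂) | g' , (g'₀ , g'₁ , g'₂) =
    opposite-vertex-unique (proj₁ Fu) (proj₁ (proj₂ Fu))
      (proj₂ (proj₂ (ZigzagAt.distinct-after Zu i)))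
      g≢f (g₁ , g₂ , g₀) (IsZigzag.is-edge Zu i) (proj₁ (IsZigzag.disjoint Zu i))
      g'≢f (∈-resp (sym e₁) g'₁ , ∈-resp (sym e₂) g'₂ , g'₀)
      (λ e → IsZigzag.is-edge Zu' i (trans e e₁)) (λ e → proj₁ (IsZigzag.disjoint Zu' i) (trans e e₂))
    where
    g≢f : g ≢ f
    g≢f = IsZigzag.faces-differ Zu i g f (g₀ , g₁ , g₂) Fu
    g'≢f : g' ≢ f
    g'≢f = IsZigzag.faces-differ Zu' i g' f (g'₀ , g'₁ , g'₂)
      (∈-resp e₁ (proj₁ Fu) , ∈-resp e₂ (proj₁ (proj₂ Fu)) , ∈-resp e₃ (proj₂ (proj₂ Fu)))

  rigidity : ∀ {u u'} → IsZigzag K u → IsZigzag K u' → ∀ i → u i ≡ u' i → u (i ⊕ 1) ≡ u' (i ⊕ 1) →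
             u (i ⊕ 2) ≡ u' (i ⊕ 2) → ∀ t → u t ≡ u' t
  rigidity {u} {u'} Zu Zu' i e₀ e₁ e₂ t =
    proj₁ (subst Agree (translate₀ i t) (ℤ-induction (λ d → Agree (i +ℤ d)) base up down (t -ℤ i)))
    where
    Agree : ℤ → Set
    Agree t = u t ≡ u' t × u (t ⊕ 1) ≡ u' (t ⊕ 1) × u (t ⊕ 2) ≡ u' (t ⊕ 2)
    at : ∀ {s s'} → s ≡ s' → u s ≡ u' s → u s' ≡ u' s'
    at e = subst (λ r → u r ≡ u' r) e
    forward : ∀ t → Agree t → Agree (t ⊕ 1)
    forward t (a₀ , a₁ , a₂) =
      a₁ , at (sym (⊕-assoc t 1 1)) a₂ , at (sym (⊕-assoc t 1 2)) (step-forward Zu Zu' t a₀ a₁ a₂)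
    backward : ∀ t → Agree (t ⊕ 1) → Agree t
    backward t (a₁ , a₂ , a₃) =
      step-backward Zu Zu' t a₁ (at (⊕-assoc t 1 1) a₂) (at (⊕-assoc t 1 2) a₃) ,
      a₁ , at (⊕-assoc t 1 1) a₂
    base : Agree (i +ℤ + 0)
    base = subst Agree (sym (ZP.+-identityʳ i)) (e₀ , e₁ , e₂)
    up : ∀ d → Agree (i +ℤ d) → Agree (i +ℤ (d ⊕ 1))
    up d a = subst Agree (ZP.+-assoc i d (+ 1)) (forward (i +ℤ d) a)
    down : ∀ d → Agree (i +ℤ (d ⊕ 1)) → Agree (i +ℤ d)
    down d a = backward (i +ℤ d) (subst Agree (sym (ZP.+-assoc i d (+ 1))) a)

  rigidity-at : ∀ {u u'} → IsZigzag K u → IsZigzag K u' → ∀ j a b c →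
                FlagAt u j a b c → FlagAt u' j a b c → ∀ t → u t ≡ u' t
  rigidity-at {u} {u'} Zu Zu' j a b c (f₀ , f₁ , f₂) (g₀ , g₁ , g₂) =
    rigidity Zu Zu' (+ j) (trans f₀ (sym g₀)) (at (+-⊕ j 1) (trans f₁ (sym g₁)))
      (at (+-⊕ j 2) (trans f₂ (sym g₂)))
    where
    at : ∀ {s s'} → s' ≡ s → u s ≡ u' s → u s' ≡ u' s'
    at e = subst (λ r → u r ≡ u' r) (sym e)

module Periods (K : Complex) (T : IsTriangulation K) where
  open Triangulated K T
  open Sequences K

  shifted-copy : ∀ {v w} → IsZigzag K v → IsZigzag K w → ∀ i P {a b c} →
                 FlagAt v P a b c → FlagFrom w i a b c → SameZ K v w
  shifted-copy {v} Zv Zw i P (f₀ , f₁ , f₂) (e₀ , e₁ , e₂) =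
    k , rigidity Zw (shift-zigzag Zv k) i
          (trans e₀ (sym (trans (cong v (translate₀ i (+ P))) f₀)))
          (trans e₁ (sym (trans (cong v (trans (translate i (+ P) (+ 1)) (+-⊕ P 1))) f₁)))
          (trans e₂ (sym (trans (cong v (trans (translate i (+ P) (+ 2)) (+-⊕ P 2))) f₂)))
    where
    k : ℤ
    k = + P -ℤ i

  reflected-copy : ∀ {v w} → IsZigzag K v → IsZigzag K w → ∀ i P {a b c} →
                   FlagAt v P c b a → FlagFrom w i a b c → ∀ t → w t ≡ v ((i +ℤ ((+ P) ⊕ 2)) -ℤ t)
  reflected-copy {v} Zv Zw i P (f₀ , f₁ , f₂) (e₀ , e₁ , e₂) =
    rigidity Zw (reverse-zigzag Zv (i +ℤ ((+ P) ⊕ 2))) i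
      (trans e₀ (sym (trans (cong v (trans (reflect₀ i (+ P)) (+-⊕ P 2))) f₂)))
      (trans e₁ (sym (trans (cong v (trans (reflect₁ i (+ P)) (+-⊕ P 1))) f₁)))
      (trans e₂ (sym (trans (cong v (reflect₂ i (+ P))) f₀)))

  -- A zigzag never shows a flag together with its reverse: it would be a
  -- reflection of itself.
  flag-not-reversed : ∀ {v} → IsZigzag K v → ∀ j P {a b c} →
                      FlagAt v j a b c → FlagAt v P c b a → ⊥
  flag-not-reversed {v} Zv j P fj fP = no-self-reflection Zv (j N.+ (P N.+ 2))
    (reflected-copy Zv Zv (+ j) P fP (flagAt⇒flagFrom {v} {j} fj))

  RotatedFlags : (ℤ → V K) → V K → V K → V K → ℕ → ℕ → ℕ → Set
  RotatedFlags v x y z P₁ P₂ P₃ = FlagAt v P₁ x y z × FlagAt v P₂ y z x × FlagAt v P₃ z x y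

  through-face-same-or-reversed : ∀ {v G x y z P₁ P₂ P₃} → IsZigzag K v →
    InFace3 K G x y z → Distinct x y z → RotatedFlags v x y z P₁ P₂ P₃ →
    ∀ w → IsZigzag K w → ShadowContains K w G → SameOrRev K v w
  through-face-same-or-reversed {P₁ = P₁} {P₂} {P₃} Zv xyz dist (F₁ , F₂ , F₃) w Zw (i , sh)
    with orientation xyz dist sh (ZigzagAt.distinct-after Zw i)
  ... | inj₁ (inj₁ fl) = inj₁ (shifted-copy Zv Zw i P₁ F₁ fl)
  ... | inj₁ (inj₂ (inj₁ fl)) = inj₁ (shifted-copy Zv Zw i P₂ F₂ fl)
  ... | inj₁ (inj₂ (inj₂ fl)) = inj₁ (shifted-copy Zv Zw i P₃ F₃ fl)
  ... | inj₂ (inj₁ fl) = inj₂ (i +ℤ ((+ P₁) ⊕ 2) , reflected-copy Zv Zw i P₁ F₁ fl)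
  ... | inj₂ (inj₂ (inj₁ fl)) = inj₂ (i +ℤ ((+ P₃) ⊕ 2) , reflected-copy Zv Zw i P₃ F₃ fl)
  ... | inj₂ (inj₂ (inj₂ fl)) = inj₂ (i +ℤ ((+ P₂) ⊕ 2) , reflected-copy Zv Zw i P₂ F₂ fl)

  Recurs : (ℤ → V K) → ℕ → Set
  Recurs v m = 0 N.< m × FlagAt v m (v (+ 0)) (v (+ 1)) (v (+ 2))

  recurs? : ∀ v m → Dec (Recurs v m)
  recurs? v m = (0 N.<? m) ×-dec ((v (+ m) ≟ v (+ 0)) ×-dec ((v (+ suc m) ≟ v (+ 1)) ×-dec
                 (v (+ suc (suc m)) ≟ v (+ 2))))

  -- Every zigzag has a minimal period n: the first recurrence of its flag at 0.
  minimal-period : ∀ {v} → IsZigzag K v → Σ ℕ λ n → MinPeriod K v n × Recurs v n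
  minimal-period {v} Zv with IsZigzag.cyclic Zv
  ... | N , N>0 , perN with least-witness (recurs? v) N (N>0 , perN (+ 0) , perN (+ 1) , perN (+ 2))
  ...   | n , (n>0 , Fn) , earlier = n , (n>0 , period , minimal) , (n>0 , Fn)
    where
    period : ∀ i → v (i ⊕ n) ≡ v i
    period i = sym (rigidity-at Zv (shift-zigzag Zv (+ n)) 0 _ _ _ (refl , refl , refl) Fn i)
    minimal : ∀ m → 0 N.< m → m N.< n → ¬ (∀ i → v (i ⊕ m) ≡ v i)
    minimal m m>0 m<n per = earlier m m<n (m>0 , per (+ 0) , per (+ 1) , per (+ 2))

  module WithinPeriod {v} (Zv : IsZigzag K v) {n} (mp : MinPeriod K v n) where

    no-early-recurrence : ∀ {j P a b c} → j N.< P → P N.< n →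
                          FlagAt v j a b c → FlagAt v P a b c → ⊥
    no-early-recurrence {j} {P} {a} {b} {c} j<P P<n Fj FP =
      proj₂ (proj₂ mp) d (NP.m<n⇒0<n∸m j<P) (NP.≤-<-trans (NP.m∸n≤m P j) P<n)
        (λ i → sym (rigidity-at Zv (shift-zigzag Zv (+ d)) j a b c Fj
                      (subst (λ m → FlagAt v m a b c) (sym (NP.m+[n∸m]≡n (NP.<⇒≤ j<P))) FP) i))
      where
      d : ℕ
      d = P N.∸ j

    flag-once : ∀ {j P a b c} → j N.< n → P N.< n → FlagAt v j a b c → FlagAt v P a b c → j ≡ P
    flag-once {j} {P} j<n P<n Fj FP with NP.<-cmp j P
    ... | tri< j<P _ _ = ⊥-elim (no-early-recurrence j<P P<n Fj FP)
    ... | tri≈ _ j≡P _ = j≡P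
    ... | tri> _ _ P<j = ⊥-elim (no-early-recurrence P<j j<n FP Fj)

    shadow-positions : ∀ {G x y z P₁ P₂ P₃} → InFace3 K G x y z → Distinct x y z →
      P₁ N.< n → P₂ N.< n → P₃ N.< n → RotatedFlags v x y z P₁ P₂ P₃ →
      ∀ j → j N.< n → ShadowAt v j G → j ≡ P₁ ⊎ j ≡ P₂ ⊎ j ≡ P₃
    shadow-positions {P₁ = P₁} {P₂} {P₃} xyz dist P₁<n P₂<n P₃<n (F₁ , F₂ , F₃) j j<n sh
      with orientation xyz dist sh (ZigzagAt.distinct-at Zv j)
    ... | inj₁ (inj₁ fl) = inj₁ (flag-once j<n P₁<n fl F₁)
    ... | inj₁ (inj₂ (inj₁ fl)) = inj₂ (inj₁ (flag-once j<n P₂<n fl F₂))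
    ... | inj₁ (inj₂ (inj₂ fl)) = inj₂ (inj₂ (flag-once j<n P₃<n fl F₃))
    ... | inj₂ (inj₁ fl) = ⊥-elim (flag-not-reversed Zv j P₁ fl F₁)
    ... | inj₂ (inj₂ (inj₁ fl)) = ⊥-elim (flag-not-reversed Zv j P₃ fl F₃)
    ... | inj₂ (inj₂ (inj₂ fl)) = ⊥-elim (flag-not-reversed Zv j P₂ fl F₂)

module Monodromy (K : Complex) (T : IsTriangulation K) where
  open Triangulated K T
  open Sequences K

  AvoidsUntil : (ℤ → V K) → Face K → ℕ → Set
  AvoidsUntil u G j = ∀ k → 2 N.≤ k → k N.< j → ¬ (u (+ k) ∈ᶠ G × u (+ suc k) ∈ᶠ G)

  avoided-before : ∀ u {G j} → AvoidsUntil u G j → ∀ k → 2 N.≤ k →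
                   u (+ k) ∈ᶠ G → u (+ suc k) ∈ᶠ G → j ≢ k → j N.< k
  avoided-before u {j = j} avoids k k≥2 uk u1k j≢k with NP.<-cmp j k
  ... | tri< j<k _ _ = j<k
  ... | tri≈ _ j≡k _ = ⊥-elim (j≢k j≡k)
  ... | tri> _ _ k<j = ⊥-elim (avoids k k≥2 k<j (uk , u1k))

  MonodromyReturn : (ℤ → V K) → Face K → V K → V K → V K → Set
  MonodromyReturn u G p q r = Σ ℕ λ j → 2 N.≤ j × FlagAt u j r p q × AvoidsUntil u G j

  continues-in-face : ∀ {u G p q r} → IsZigzag K u → InFace3 K G p q r → Distinct p q r →
    u (+ 0) ≡ p → ∀ j → 2 N.≤ j → AvoidsUntil u G j → u (+ j) ≡ r → u (+ suc j) ≡ p →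
    u (+ suc (suc j)) ≡ q
  continues-in-face Zu pqr dist u₀ 1 (s≤s ()) _ _ _
  -- (j = 2 would give u₃ = p = u₀, against disjointness.)
  continues-in-face Zu pqr dist u₀ 2 _ _ _ u₃ =
    ⊥-elim (proj₁ (proj₂ (ZigzagAt.disjoint-at Zu 0)) (trans u₀ (sym u₃)))
  continues-in-face {u} {G} {p} {q} {r} Zu (pG , qG , rG) dist u₀ (suc (suc (suc i))) _
                    avoids uj uj₁ =
    last-vertex (rG , pG , qG) (rotate-distinct (rotate-distinct dist))
      (proj₂ (proj₂ entered))
      (λ e → proj₁ (disjoint-at (suc (suc (suc i)))) (trans uj (sym e)))
      (λ e → edge-at (suc (suc (suc (suc i)))) (trans uj₁ (sym e)))
    where
    open ZigzagAt Zu
    open ZigzagDynamics Zu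
    entered : ShadowAt u (suc (suc (suc i))) G
    entered = entering-face (suc (suc i)) G
      (λ m → avoids (suc (suc i)) (s≤s (s≤s z≤n)) (NP.n<1+n _) (m , ∈-resp (sym uj) rG))
      (∈-resp (sym uj) rG) (∈-resp (sym uj₁) pG)

  monodromy-return : ∀ {G u p q r} → MonodromyIsD K G → IsZigzag K u → InFace3 K G p q r →
                     Distinct p q r → FlagAt u 0 p q r → MonodromyReturn u G p q r
  monodromy-return {G} {u} {p} {q} {r} MG Zu pqr (pq , pr , qr) Fu
    with MG p q r pqr pq qr pr
  ... | m , Zm , m₀ , m₁ , m₂ , j , j≥2 , mj , mj₁ , avoids-m =
    j , j≥2 , (uj , uj₁ , continues-in-face Zu pqr (pq , pr , qr) (proj₁ Fu) j j≥2 avoids uj uj₁) ,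
    avoids
    where
    m≡u : ∀ t → m t ≡ u t
    m≡u = rigidity-at Zm Zu 0 p q r (m₀ , m₁ , m₂) Fu
    uj : u (+ j) ≡ r
    uj = trans (sym (m≡u _)) mj
    uj₁ : u (+ suc j) ≡ p
    uj₁ = trans (sym (m≡u _)) mj₁
    avoids : AvoidsUntil u G j
    avoids k k≥2 k<j (a , b) =
      avoids-m k k≥2 k<j (∈-resp (sym (m≡u _)) a , ∈-resp (sym (m≡u _)) b)

module Configuration (K : Complex) (T : IsTriangulation K) {F F' : Face K} {x y z w : V K}
  (F≢F' : F ≢ F') (xyz : InFace3 K F x y z) (yzw : InFace3 K F' y z w)
  (dist-F : Distinct x y z) (dist-F' : Distinct y z w)
  (MF : MonodromyIsD K F) (MF' : MonodromyIsD K F')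
  {v : ℤ → V K} (Zv : IsZigzag K v) (F₀ : Sequences.FlagAt K v 0 x y z)
  where
  open Triangulated K T
  open Sequences K
  open Periods K T
  open Monodromy K T
  open ZigzagDynamics Zv

  period : Σ ℕ λ n → MinPeriod K v n × Recurs v n
  period = minimal-period Zv

  n : ℕ
  n = proj₁ period

  mp : MinPeriod K v n
  mp = proj₁ (proj₂ period)

  Fn : FlagAt v n x y z
  Fn with proj₂ (proj₂ period)
  ... | _ , e₀ , e₁ , e₂ =
    trans e₀ (proj₁ F₀) , trans e₁ (proj₁ (proj₂ F₀)) , trans e₂ (proj₂ (proj₂ F₀))

  open WithinPeriod Zv mp

  return-F : MonodromyReturn v F x y z
  return-F = monodromy-return MF Zv xyz dist-F F₀

  a : ℕ
  a = proj₁ return-F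

  Fa : FlagAt v a z x y
  Fa = proj₁ (proj₂ (proj₂ return-F))

  F₁ : FlagAt v 1 y z w
  F₁ = cross-edge 0 F₀ xyz (λ e → F≢F' (sym e)) yzw dist-F'

  return-F'₁ : MonodromyReturn (λ t → v (t +ℤ + 1)) F' y z w
  return-F'₁ = monodromy-return MF' (shift-zigzag Zv (+ 1)) yzw dist-F' F₁

  b : ℕ
  b = proj₁ return-F'₁ N.+ 1

  Fb : FlagAt v b w y z
  Fb = proj₁ (proj₂ (proj₂ return-F'₁))

  Fb₁ : FlagAt v (suc b) y z x
  Fb₁ = cross-edge b Fb (rotate-InFace3 (rotate-InFace3 yzw)) F≢F'
          (rotate-InFace3 xyz) (rotate-distinct dist-F)

  return-F'₂ : MonodromyReturn (λ t → v (t +ℤ + b)) F' w y z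
  return-F'₂ = monodromy-return MF' (shift-zigzag Zv (+ b)) (rotate-InFace3 (rotate-InFace3 yzw))
                 (rotate-distinct (rotate-distinct dist-F')) Fb

  c : ℕ
  c = proj₁ return-F'₂ N.+ b

  Fc : FlagAt v c z w y
  Fc = proj₁ (proj₂ (proj₂ return-F'₂))

  -- x ≠ w, as F ≠ F' and a face is determined by three vertices.
  x≢w : x ≢ w
  x≢w refl = F≢F' (face-determined xyz (rotate-InFace3 (rotate-InFace3 yzw)) dist-F)

  -- n ≠ 1, as v shows x at n but y at 1.
  n≥2 : 2 N.≤ n
  n≥2 = NP.≤∧≢⇒< (proj₁ mp) (positions-differ v F₁ Fn (λ e → proj₁ dist-F (sym e)))

  -- The flag (x,y,z) recurs at n, so the edge yz of F' appears at n + 1; a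
  -- return to F' searched from a position s < n therefore happens by then.
  returns-by-n : ∀ s j → s N.< n → AvoidsUntil (λ t → v (t +ℤ + s)) F' j → v (+ (j N.+ s)) ≢ y →
                 j N.+ s N.≤ n
  returns-by-n s j s<n avoids vjs≢y = NP.≤-pred (subst (j N.+ s N.<_) k+s≡1+n (NP.+-monoˡ-< s j<k))
    where
    k : ℕ
    k = suc n N.∸ s
    k+s≡1+n : k N.+ s ≡ suc n
    k+s≡1+n = NP.m∸n+n≡m (NP.≤-trans (NP.<⇒≤ s<n) (NP.n≤1+n n))
    k≥2 : 2 N.≤ k
    k≥2 = subst (2 N.≤_) (sym (NP.+-∸-assoc 1 (NP.<⇒≤ s<n))) (s≤s (NP.m<n⇒0<n∸m s<n))
    j<k : j N.< k
    j<k = avoided-before (λ t → v (t +ℤ + s)) avoids k k≥2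
      (∈-resp (sym (trans (cong (λ t → v (+ t)) k+s≡1+n) (proj₁ (proj₂ Fn)))) (proj₁ yzw))
      (∈-resp (sym (trans (cong (λ t → v (+ suc t)) k+s≡1+n) (proj₂ (proj₂ Fn)))) (proj₁ (proj₂ yzw)))
      (λ j≡k → vjs≢y (trans (cong (λ t → v (+ (t N.+ s))) j≡k)
                              (trans (cong (λ t → v (+ t)) k+s≡1+n) (proj₁ (proj₂ Fn)))))

  a>1 : 1 N.< a
  a>1 = proj₁ (proj₂ return-F)

  a<b : a N.< b
  a<b = NP.≤∧≢⇒< (NP.≤-pred a<1+b) (positions-differ v Fa Fb (proj₂ (proj₂ dist-F')))
    where
    a<1+b : a N.< suc b
    a<1+b = avoided-before v (proj₂ (proj₂ (proj₂ return-F))) (suc b)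
      (s≤s (NP.m≤n+m 1 (proj₁ return-F'₁)))
      (∈-resp (sym (proj₁ Fb₁)) (proj₁ (proj₂ xyz)))
      (∈-resp (sym (proj₁ (proj₂ Fb₁))) (proj₂ (proj₂ xyz)))
      (positions-differ v Fa Fb₁ (λ e → proj₂ (proj₂ dist-F) (sym e)))

  b<n : b N.< n
  b<n = NP.≤∧≢⇒< (returns-by-n 1 (proj₁ return-F'₁) n≥2 (proj₂ (proj₂ (proj₂ return-F'₁)))
                   (λ e → proj₁ (proj₂ dist-F') (sym (trans (sym (proj₁ Fb)) e))))
                 (positions-differ v Fb Fn (λ e → x≢w (sym e)))

  1+b<c : suc b N.< c
  1+b<c = NP.+-monoˡ-≤ b (proj₁ (proj₂ return-F'₂))

  c<n : c N.< n
  c<n = NP.≤∧≢⇒< (returns-by-n b (proj₁ return-F'₂) b<n (proj₂ (proj₂ (proj₂ return-F'₂)))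
                   (λ e → proj₁ dist-F' (sym (trans (sym (proj₁ Fc)) e))))
                 (positions-differ v Fc Fn (λ e → proj₁ (proj₂ dist-F) (sym e)))

  flags-F : RotatedFlags v x y z 0 (suc b) a
  flags-F = F₀ , Fb₁ , Fa

  flags-F' : RotatedFlags v y z w 1 c b
  flags-F' = F₁ , Fc , Fb

  contains-F : ShadowContains K v F
  contains-F = + 0 , flag-in-shadow v 0 F₀ xyz

  contains-F' : ShadowContains K v F'
  contains-F' = + 1 , flag-in-shadow v 1 F₁ yzw

  unique : ∀ u → IsZigzag K u → ShadowContains K u F → ShadowContains K u F' → SameOrRev K v u
  unique u Zu through-F _ = through-face-same-or-reversed Zv xyz dist-F flags-F u Zu through-F

  shadow-pattern : Pattern K v F F'
  shadow-pattern = n , mp , a , b , c , a>1 , a<b , 1+b<c , c<n ,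
    shadow F₀ xyz , shadow F₁ yzw , shadow Fa (rotate-InFace3 (rotate-InFace3 xyz)) ,
    shadow Fb (rotate-InFace3 (rotate-InFace3 yzw)) , shadow Fb₁ (rotate-InFace3 xyz) ,
    shadow Fc (rotate-InFace3 yzw) , elsewhere
    where
    shadow : ∀ {j G p q r} → FlagAt v j p q r → InFace3 K G p q r → Shadow K v (+ j) G
    shadow {j} = flag-in-shadow v j
    elsewhere : ∀ j → j N.< n → j ≢ 0 → j ≢ 1 → j ≢ a → j ≢ b → j ≢ suc b → j ≢ c →
                ¬ Shadow K v (+ j) F × ¬ Shadow K v (+ j) F'
    elsewhere j j<n j≢0 j≢1 j≢a j≢b j≢1+b j≢c =
      (λ s → [ j≢0 , [ j≢1+b , j≢a ]′ ]′
        (shadow-positions xyz dist-F (proj₁ mp) (NP.<-trans 1+b<c c<n) (NP.<-trans a<b b<n)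
          flags-F j j<n (shadow⇒shadowAt v j F s))) ,
      (λ s → [ j≢1 , [ j≢c , j≢b ]′ ]′
        (shadow-positions yzw dist-F' n≥2 c<n b<n flags-F' j j<n (shadow⇒shadowAt v j F' s)))

lemma3 : (K : Complex) → IsTriangulation K →
    (F F' : Face K) → Adjacent K F F' →
    MonodromyIsD K F → MonodromyIsD K F' →
    Σ (ℤ → V K) λ v →
      IsZigzag K v × ShadowContains K v F × ShadowContains K v F' ×
      (∀ w → IsZigzag K w → ShadowContains K w F → ShadowContains K w F' →
        SameOrRev K v w) ×
      (∃[ w ] (SameOrRev K v w × Pattern K w F F'))
lemma3 K T F F' (F≢F' , y , z , y≢z , yF , zF , yF' , zF') MF MF'
  with Triangulated.third-vertex K T yF zF y≢z | Triangulated.third-vertex K T yF' zF' y≢z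
... | x , xF , x≢y , x≢z | w , wF' , w≢y , w≢z
  with MF x y z (xF , yF , zF) x≢y y≢z x≢z
... | v , Zv , v₀ , v₁ , v₂ , _ =
  v , Zv , contains-F , contains-F' , unique , (v , Sequences.SameOrRev-refl K v , shadow-pattern)
  where
  open Configuration K T F≢F' (xF , yF , zF) (yF' , zF' , wF') (x≢y , x≢z , y≢z)
    (y≢z , (λ e → w≢y (sym e)) , (λ e → w≢z (sym e))) MF MF' Zv (v₀ , v₁ , v₂)
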